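{- Let $G=(U,V,E)$ be a finite connected bipartite graph with $|U|\le |V|$, and let $\mathcal{M}$ and $\mathcal{M}'$ be two matchings of $G$ such that the symmetric difference $\mathcal{M}\triangle\mathcal{M}'$ is a disjoint union of cycles. Then $K_{\mathcal{M}}(G)=K_{\mathcal{M}'}(G)$.
   Context: A matching is a set of edges no two sharing an endpoint; a vertex is saturated by a matching if it is an endpoint of an edge of the matching. Given a matching $\mathcal{M}$, an alternating path is a path whose consecutive edges alternate between edges not in $\mathcal{M}$ and edges in $\mathcal{M}$. K\H{o}nig's procedure: with $U$ the smaller side ($|U|\le|V|$), let $Z_{\mathcal{M}}(G)$ be the set of all vertices reachable by an alternating path starting at a vertex of $U$ that is unsaturated by $\mathcal{M}$ (the unsaturated vertices of $U$ themselves included), and set $K_{\mathcal{M}}(G):=(U\setminus Z_{\mathcal{M}}(G))\cup(V\cap Z_{\mathcal{M}}(G))$. -}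

module Defs where

open import Data.Nat using (ℕ; _≤_)
open import Data.Fin using (Fin)
open import Data.Bool using (Bool; true; false; _xor_)
open import Data.Sum using (_⊎_; inj₁; inj₂)
open import Data.Product using (Σ; ∃; _×_; _,_)
open import Data.Empty using (⊥)
open import Data.Maybe using (just)
open import Data.List using (List; []; _∷_; _∷ʳ_; length; head; last)
open import Data.List.Membership.Propositional using (_∈_; _∉_)
open import Data.List.Relation.Unary.Any using (Any)
open import Data.List.Relation.Unary.All using (All)
open import Data.List.Relation.Unary.AllPairs using (AllPairs)
open import Data.List.Relation.Unary.Unique.Propositional using (Unique)
open import Relation.Nullary using (¬_)
open import Relation.Binary.PropositionalEquality using (_≡_; _≢_)
open import Function.Bundles using (_⇔_)

-- A bipartite graph G = (U, V, E) with U = Fin m, V = Fin n, given by its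
-- edge relation E u v (edges only go between U and V).
-- Vertices of G:
Vertex : ℕ → ℕ → Set
Vertex m n = Fin m ⊎ Fin n

rel : {m n : ℕ} → (Fin m → Fin n → Bool) → Vertex m n → Vertex m n → Bool
rel R (inj₁ u) (inj₂ v) = R u v
rel R (inj₂ v) (inj₁ u) = R u v
rel R (inj₁ _) (inj₁ _) = false
rel R (inj₂ _) (inj₂ _) = false

Adj : {m n : ℕ} → (Fin m → Fin n → Bool) → Vertex m n → Vertex m n → Set
Adj E x y = rel E x y ≡ true

data Walk {m n : ℕ} (E : Fin m → Fin n → Bool) : Vertex m n → Vertex m n → Set where
  stay : ∀ x → Walk E x x
  step : ∀ {x y z} → Adj E x y → Walk E y z → Walk E x z

Connected : {m n : ℕ} → (Fin m → Fin n → Bool) → Set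
Connected E = ∀ x y → Walk E x y

record IsMatching {m n : ℕ} (E M : Fin m → Fin n → Bool) : Set where
  field
    sub   : ∀ u v → M u v ≡ true → E u v ≡ true
    uniqV : ∀ u v v′ → M u v ≡ true → M u v′ ≡ true → v ≡ v′
    uniqU : ∀ u u′ v → M u v ≡ true → M u′ v ≡ true → u ≡ u′

SaturatedU : {m n : ℕ} → (Fin m → Fin n → Bool) → Fin m → Set
SaturatedU M u = ∃ λ v → M u v ≡ true

data Alternating {m n : ℕ} (E M : Fin m → Fin n → Bool) : List (Vertex m n) → Set where
  single : ∀ x → Alternating E M (x ∷ [])
  two    : ∀ {x y} → Adj E x y → Alternating E M (x ∷ y ∷ [])
  more   : ∀ {x y z rest} → Adj E x y → rel M x y ≢ rel M y z →
           Alternating E M (y ∷ z ∷ rest) → Alternating E M (x ∷ y ∷ z ∷ rest)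

AltPath : {m n : ℕ} → (E M : Fin m → Fin n → Bool) → List (Vertex m n) → Set
AltPath E M p = Alternating E M p × Unique p

InZ : {m n : ℕ} → (E M : Fin m → Fin n → Bool) → Vertex m n → Set
InZ E M w = Σ (Fin _) λ u → ¬ SaturatedU M u ×
            Σ (List (Vertex _ _)) λ p → AltPath E M p ×
              head p ≡ just (inj₁ u) × last p ≡ just w

InK : {m n : ℕ} → (E M : Fin m → Fin n → Bool) → Vertex m n → Set
InK E M (inj₁ u) = ¬ InZ E M (inj₁ u)
InK E M (inj₂ v) = InZ E M (inj₂ v)

-- cycles: a cycle is given by a list x ∷ xs of ≥ 3 distinct vertices;
-- its edges are consecutive pairs and the closing pair (last, x).
data Consec {A : Set} : List A → A → A → Set where
  here  : ∀ {a b xs} → Consec (a ∷ b ∷ xs) a b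
  there : ∀ {c a b xs} → Consec xs a b → Consec (c ∷ xs) a b

CycleList : Set → Set
CycleList A = Σ A λ x → List A

cycVerts : {A : Set} → CycleList A → List A
cycVerts (x , xs) = x ∷ xs

CycEdge : {A : Set} → CycleList A → A → A → Set
CycEdge (x , xs) a b = Consec ((x ∷ xs) ∷ʳ x) a b ⊎ Consec ((x ∷ xs) ∷ʳ x) b a

IsCycleShape : {A : Set} → CycleList A → Set
IsCycleShape (x , xs) = (2 ≤ length xs) × Unique (x ∷ xs)

VertexDisjoint : {A : Set} → CycleList A → CycleList A → Set
VertexDisjoint c d = ∀ z → z ∈ cycVerts c → z ∉ cycVerts d

SymDiffUnionOfCycles : {m n : ℕ} → (M M′ : Fin m → Fin n → Bool) → Set
SymDiffUnionOfCycles {m} {n} M M′ =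
  Σ (List (CycleList (Vertex m n))) λ cs →
    All IsCycleShape cs × AllPairs VertexDisjoint cs ×
    (∀ x y → (rel M x y xor rel M′ x y ≡ true) ⇔ Any (λ c → CycEdge c x y) cs)

-- Z_M is the set of vertices reachable from the M-unsaturated vertices of U in the
-- alternating digraph of M, which runs along non-matching edges from U to V and along
-- matching edges from V to U. Around a cycle of M △ M′ the edges alternate between M and
-- M′, so each such cycle is a directed cycle of the alternating digraph of M′. Hence an
-- arc of M's digraph that is not an arc of M′'s lies on a directed cycle of M′'s digraph
-- and can be replaced by a detour around it; every vertex on such a cycle has an incoming
-- M′-edge, so M and M′ saturate the same vertices. Thus Z_M = Z_M′, and so K_M = K_M′.
module Submission where

open import Defs
open import Data.Nat using (ℕ; _≤_; s≤s)
open import Data.Fin using (Fin) renaming (_≟_ to _≟ᶠ_)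
open import Data.Bool using (Bool; true; false; not; _xor_) renaming (_≟_ to _≟ᵇ_)
open import Data.Bool.Properties using (¬-not; not-¬; xor-comm)
open import Data.Sum using (_⊎_; inj₁; inj₂)
open import Data.Sum.Properties using (≡-dec)
open import Data.Product using (∃; _×_; _,_; proj₁; proj₂; swap)
open import Data.Empty using (⊥-elim)
open import Data.Maybe using (just)
open import Data.List using (List; []; _∷_; _∷ʳ_; last)
open import Data.List.Membership.Propositional using (_∈_; _∉_; find; lose)
open import Data.List.Relation.Unary.Any using (here; there; any?)
open import Data.List.Relation.Unary.All using ([]; _∷_)
import Data.List.Relation.Unary.All as All
open import Data.List.Relation.Unary.All.Properties using (¬Any⇒All¬; All¬⇒¬Any)
open import Data.List.Relation.Unary.Linked using (Linked; []; [-]; _∷_)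
open import Data.List.Relation.Unary.AllPairs using ([]; _∷_)
open import Data.List.Relation.Unary.Unique.Propositional using (Unique)
open import Relation.Binary.Construct.Closure.ReflexiveTransitive
  using (Star; ε; _◅_; _◅◅_; _>>=_; reverse)
open import Relation.Binary.Definitions using (DecidableEquality)
open import Relation.Binary.PropositionalEquality
  using (_≡_; _≢_; refl; sym; trans; cong; cong₂; ≢-sym; module ≡-Reasoning)
open import Relation.Nullary using (¬_; yes; no)
open import Function.Base using (id; _∘_; case_of_)
open import Function.Bundles using (_⇔_; mk⇔; Equivalence)

xor≡true⇒≡not : ∀ {x y} → x xor y ≡ true → x ≡ not y
xor≡true⇒≡not {true}  {false} _ = refl
xor≡true⇒≡not {false} {true}  _ = refl
xor≡true⇒≡not {true}  {true}  ()
xor≡true⇒≡not {false} {false} ()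

≢⇒xor≡true : ∀ {x y} → x ≢ y → x xor y ≡ true
≢⇒xor≡true {true}  {false} _ = refl
≢⇒xor≡true {false} {true}  _ = refl
≢⇒xor≡true {true}  {true}  x≢y = ⊥-elim (x≢y refl)
≢⇒xor≡true {false} {false} x≢y = ⊥-elim (x≢y refl)

last-∷ʳ : ∀ {A : Set} (xs : List A) x → last (xs ∷ʳ x) ≡ just x
last-∷ʳ []           x = refl
last-∷ʳ (_ ∷ [])     x = refl
last-∷ʳ (_ ∷ y ∷ xs) x = last-∷ʳ (y ∷ xs) x

module _ {A : Set} {R : A → A → Set} where

  Linked⇒Star-from-head : ∀ {x xs w} → Linked R (x ∷ xs) → w ∈ x ∷ xs → Star R x w
  Linked⇒Star-from-head _        (here refl) = ε
  Linked⇒Star-from-head (r ∷ rs) (there w∈)  = r ◅ Linked⇒Star-from-head rs w∈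

  Linked⇒Star-to-last : ∀ {x xs w y} → Linked R (x ∷ xs) → last (x ∷ xs) ≡ just y →
                        w ∈ x ∷ xs → Star R w y
  Linked⇒Star-to-last [-]      refl (here refl) = ε
  Linked⇒Star-to-last [-]      _    (there ())
  Linked⇒Star-to-last (r ∷ rs) l    (here refl) = r ◅ Linked⇒Star-to-last rs l (here refl)
  Linked⇒Star-to-last (r ∷ rs) l    (there w∈)  = Linked⇒Star-to-last rs l w∈

  closed-Linked⇒Star : ∀ {x xs a b} → Linked R (x ∷ xs) → last (x ∷ xs) ≡ just x →
                       a ∈ x ∷ xs → b ∈ x ∷ xs → Star R a b
  closed-Linked⇒Star rs closed a∈ b∈ =
    Linked⇒Star-to-last rs closed a∈ ◅◅ Linked⇒Star-from-head rs b∈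

  Star-final-step : ∀ {x y} → x ≢ y → Star R x y → ∃ λ z → R z y
  Star-final-step x≢y ε        = ⊥-elim (x≢y refl)
  Star-final-step _   (r ◅ rs) = final-step r rs
    where
    final-step : ∀ {x y z} → R x y → Star R y z → ∃ λ w → R w z
    final-step r ε        = _ , r
    final-step _ (r ◅ rs) = final-step r rs

  SimplePath : A → A → Set
  SimplePath x y = ∃ λ xs → Linked R (x ∷ xs) × Unique (x ∷ xs) × last (x ∷ xs) ≡ just y

  SimplePath-suffix : ∀ {x xs y w} → Linked R (x ∷ xs) → Unique (x ∷ xs) →
                      last (x ∷ xs) ≡ just y → w ∈ x ∷ xs → SimplePath w y
  SimplePath-suffix rs       uniq       l (here refl) = _ , rs , uniq , l
  SimplePath-suffix (_ ∷ rs) (_ ∷ uniq) l (there w∈)  = SimplePath-suffix rs uniq l w∈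

  Star⇒SimplePath : DecidableEquality A → ∀ {x y} → Star R x y → SimplePath x y
  Star⇒SimplePath _≟_ ε = [] , [-] , [] ∷ [] , refl
  Star⇒SimplePath _≟_ {x} (r ◅ rs) with Star⇒SimplePath _≟_ rs
  ... | ys , arcs , uniq , l with any? (x ≟_) (_ ∷ ys)
  ...   | yes x∈ = SimplePath-suffix arcs uniq l x∈
  ...   | no  x∉ = _ ∷ ys , r ∷ arcs , ¬Any⇒All¬ _ x∉ ∷ uniq , l

data NonBacktracking {A : Set} : List A → Set where
  [-,-] : ∀ {x y} → NonBacktracking (x ∷ y ∷ [])
  _∷_   : ∀ {x y z zs} → x ≢ z → NonBacktracking (y ∷ z ∷ zs) →
          NonBacktracking (x ∷ y ∷ z ∷ zs)

Unique⇒NonBacktracking-∷ʳ : ∀ {A : Set} {x y z : A} xs → Unique (x ∷ y ∷ xs) →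
                            z ∉ x ∷ y ∷ xs → NonBacktracking ((x ∷ y ∷ xs) ∷ʳ z)
Unique⇒NonBacktracking-∷ʳ []       _                    z∉ = z∉ ∘ here ∘ sym ∷ [-,-]
Unique⇒NonBacktracking-∷ʳ (w ∷ ws) ((_ ∷ x≢w ∷ _) ∷ uniq) z∉ =
  x≢w ∷ Unique⇒NonBacktracking-∷ʳ ws uniq (z∉ ∘ there)

Unique⇒closed-NonBacktracking : ∀ {A : Set} {x y z : A} {xs} → Unique (x ∷ y ∷ z ∷ xs) →
                                NonBacktracking ((x ∷ y ∷ z ∷ xs) ∷ʳ x)
Unique⇒closed-NonBacktracking {xs = xs} (x≢ys@(_ ∷ x≢z ∷ _) ∷ uniq) =
  x≢z ∷ Unique⇒NonBacktracking-∷ʳ xs uniq (All¬⇒¬Any x≢ys)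

Linked-propagate : ∀ {A : Set} {R S : A → A → Set} →
                   (∀ {a b c} → a ≢ c → R a b → R b c → S a b → S b c) →
                   ∀ {x y xs} → NonBacktracking (x ∷ y ∷ xs) → Linked R (x ∷ y ∷ xs) →
                   S x y → Linked S (x ∷ y ∷ xs)
Linked-propagate continue [-,-]      _                 s = s ∷ [-]
Linked-propagate continue (x≢z ∷ nb) (r ∷ rs@(r′ ∷ _)) s =
  s ∷ Linked-propagate continue nb rs (continue x≢z r r′ s)

Consec⇒∈ : ∀ {A : Set} {xs : List A} {a b} → Consec xs a b → a ∈ xs × b ∈ xs
Consec⇒∈ here      = here refl , there (here refl)
Consec⇒∈ (there c) with Consec⇒∈ c
... | a∈ , b∈ = there a∈ , there b∈

Consec⇒Linked : ∀ {A : Set} {R : A → A → Set} xs → (∀ {a b} → Consec xs a b → R a b) →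
                Linked R xs
Consec⇒Linked []          _ = []
Consec⇒Linked (_ ∷ [])     _ = [-]
Consec⇒Linked (_ ∷ _ ∷ xs) r = r here ∷ Consec⇒Linked (_ ∷ xs) (r ∘ there)

closedWalk : ∀ {A : Set} → CycleList A → List A
closedWalk (x , xs) = (x ∷ xs) ∷ʳ x

CycEdge⇒∈ : ∀ {A : Set} (c : CycleList A) {a b} → CycEdge c a b →
            a ∈ closedWalk c × b ∈ closedWalk c
CycEdge⇒∈ (x , xs) (inj₁ c) = Consec⇒∈ c
CycEdge⇒∈ (x , xs) (inj₂ c) = swap (Consec⇒∈ c)

module _ {m n : ℕ} where

  _≟ᵛ_ : DecidableEquality (Vertex m n)
  _≟ᵛ_ = ≡-dec _≟ᶠ_ _≟ᶠ_

  onV : Vertex m n → Bool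
  onV (inj₁ _) = false
  onV (inj₂ _) = true

  rel-sym : ∀ (R : Fin m → Fin n → Bool) x y → rel R x y ≡ rel R y x
  rel-sym R (inj₁ _) (inj₁ _) = refl
  rel-sym R (inj₁ _) (inj₂ _) = refl
  rel-sym R (inj₂ _) (inj₁ _) = refl
  rel-sym R (inj₂ _) (inj₂ _) = refl

  module _ {E : Fin m → Fin n → Bool} where

    Adj-sym : ∀ {x y} → Adj E x y → Adj E y x
    Adj-sym {x} {y} adj = trans (rel-sym E y x) adj

    Adj⇒onV-flips : ∀ {x y} → Adj E x y → onV y ≡ not (onV x)
    Adj⇒onV-flips {inj₁ _} {inj₂ _} _ = refl
    Adj⇒onV-flips {inj₂ _} {inj₁ _} _ = refl
    Adj⇒onV-flips {inj₁ _} {inj₁ _} ()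
    Adj⇒onV-flips {inj₂ _} {inj₂ _} ()

    module _ {M : Fin m → Fin n → Bool} (isM : IsMatching E M) where
      open IsMatching isM

      matching⇒Adj : ∀ x y → rel M x y ≡ true → Adj E x y
      matching⇒Adj (inj₁ u) (inj₂ v) e = sub u v e
      matching⇒Adj (inj₂ v) (inj₁ u) e = sub u v e
      matching⇒Adj (inj₁ _) (inj₁ _) ()
      matching⇒Adj (inj₂ _) (inj₂ _) ()

      matching-functional : ∀ x y z → rel M x y ≡ true → rel M x z ≡ true → y ≡ z
      matching-functional (inj₁ u) (inj₂ v) (inj₂ v′) e e′ = cong inj₂ (uniqV u v v′ e e′)
      matching-functional (inj₂ v) (inj₁ u) (inj₁ u′) e e′ = cong inj₁ (uniqU u u′ v e e′)
      matching-functional (inj₁ _) (inj₁ _) _        ()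
      matching-functional (inj₂ _) (inj₂ _) _        ()
      matching-functional (inj₁ _) (inj₂ _) (inj₁ _) _ ()
      matching-functional (inj₂ _) (inj₁ _) (inj₂ _) _ ()

-- The alternating digraph of M: edges not in M run from U to V, edges of M from V to U
-- (onV x is true exactly when x lies in V).
AltArc : ∀ {m n} (E M : Fin m → Fin n → Bool) → Vertex m n → Vertex m n → Set
AltArc E M x y = Adj E x y × rel M x y ≡ onV x

Reachable : ∀ {m n} (E M : Fin m → Fin n → Bool) → Vertex m n → Set
Reachable E M w = ∃ λ u → ¬ SaturatedU M u × Star (AltArc E M) (inj₁ u) w

module _ {m n : ℕ} {E M : Fin m → Fin n → Bool} where
  open ≡-Reasoning

  AltArc-orient : ∀ {x y} → Adj E x y → AltArc E M x y ⊎ AltArc E M y x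
  AltArc-orient {x} {y} adj with rel M x y ≟ᵇ onV x
  ... | yes e  = inj₁ (adj , e)
  ... | no  ne = inj₂ (Adj-sym {E = E} {x = x} {y = y} adj , (begin
    rel M y x       ≡⟨ rel-sym M y x ⟩
    rel M x y       ≡⟨ ¬-not ne ⟩
    not (onV x)     ≡⟨ Adj⇒onV-flips adj ⟨
    onV y           ∎))

  AltArc-continues : ∀ {x y z} → AltArc E M x y → Adj E y z → rel M x y ≢ rel M y z →
                     AltArc E M y z
  AltArc-continues {x} {y} {z} (adj , e) adj′ alternates = adj′ , (begin
    rel M y z       ≡⟨ ¬-not (≢-sym alternates) ⟩
    not (rel M x y) ≡⟨ cong not e ⟩
    not (onV x)     ≡⟨ Adj⇒onV-flips adj ⟨
    onV y           ∎)

  AltArcs-alternate : ∀ {x y z} → AltArc E M x y → AltArc E M y z → rel M x y ≢ rel M y z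
  AltArcs-alternate (adj , e) (_ , e′) same = not-¬ e (trans same (trans e′ (Adj⇒onV-flips adj)))

  Alternating-head : ∀ {x y xs} → Alternating E M (x ∷ y ∷ xs) → Adj E x y
  Alternating-head (two adj)      = adj
  Alternating-head (more adj _ _) = adj

  Alternating⇒Linked : ∀ {x y xs} → AltArc E M x y → Alternating E M (x ∷ y ∷ xs) →
                       Linked (AltArc E M) (x ∷ y ∷ xs)
  Alternating⇒Linked arc (two _)          = arc ∷ [-]
  Alternating⇒Linked arc (more _ alt alts) =
    arc ∷ Alternating⇒Linked (AltArc-continues arc (Alternating-head alts) alt) alts

  Linked⇒Alternating : ∀ {x xs} → Linked (AltArc E M) (x ∷ xs) → Alternating E M (x ∷ xs)
  Linked⇒Alternating [-]                   = single _
  Linked⇒Alternating ((adj , _) ∷ [-])     = two adj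
  Linked⇒Alternating (arc ∷ arcs@(arc′ ∷ _)) =
    more (proj₁ arc) (AltArcs-alternate arc arc′) (Linked⇒Alternating arcs)

  unsaturated⇒first-edge-unmatched : ∀ {u} → ¬ SaturatedU M u → ∀ y → rel M (inj₁ u) y ≡ false
  unsaturated⇒first-edge-unmatched     unsat (inj₁ _) = refl
  unsaturated⇒first-edge-unmatched {u} unsat (inj₂ v) with M u v in e
  ... | true  = ⊥-elim (unsat (v , e))
  ... | false = refl

  InZ⇒Reachable : ∀ {w} → InZ E M w → Reachable E M w
  InZ⇒Reachable (u , unsat , []            , _          , ()   , _)
  InZ⇒Reachable (u , unsat , (_ ∷ [])      , _          , refl , refl) = u , unsat , ε
  InZ⇒Reachable (u , unsat , (_ ∷ y ∷ xs) , (alts , _) , refl , l)    =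
    u , unsat , Linked⇒Star-to-last (Alternating⇒Linked first alts) l (here refl)
    where
    first : AltArc E M (inj₁ u) y
    first = Alternating-head alts , unsaturated⇒first-edge-unmatched unsat y

  Reachable⇒InZ : ∀ {w} → Reachable E M w → InZ E M w
  Reachable⇒InZ (u , unsat , path) with Star⇒SimplePath _≟ᵛ_ path
  ... | xs , arcs , uniq , l = u , unsat , inj₁ u ∷ xs , (Linked⇒Alternating arcs , uniq) , refl , l

record SymDiffEdge {m n} (M M′ : Fin m → Fin n → Bool) (x y : Vertex m n) : Set where
  constructor symDiffEdge
  field xor≡true : rel M x y xor rel M′ x y ≡ true

SymDiffUnionOfCycles-sym : ∀ {m n} {M M′ : Fin m → Fin n → Bool} →
                           SymDiffUnionOfCycles M M′ → SymDiffUnionOfCycles M′ M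
SymDiffUnionOfCycles-sym {M = M} {M′} (cs , shapes , disjoint , iff) =
  cs , shapes , disjoint , λ x y →
    mk⇔ (Equivalence.to (iff x y) ∘ trans (xor-comm (rel M x y) (rel M′ x y)))
        (trans (xor-comm (rel M′ x y) (rel M x y)) ∘ Equivalence.from (iff x y))

module _ {m n : ℕ} {E M M′ : Fin m → Fin n → Bool}
         (isM : IsMatching E M) (isM′ : IsMatching E M′) where
  open ≡-Reasoning

  SymDiffEdge⇒Adj : ∀ {x y} → SymDiffEdge M M′ x y → Adj E x y
  SymDiffEdge⇒Adj {x} {y} (symDiffEdge xy) with rel M x y in e
  ... | true  = matching⇒Adj isM x y e
  ... | false = matching⇒Adj isM′ x y xy

  SymDiffEdge⇒in-M : ∀ {x y} → SymDiffEdge M M′ x y → rel M′ x y ≡ false → rel M x y ≡ true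
  SymDiffEdge⇒in-M (symDiffEdge xy) e = trans (xor≡true⇒≡not xy) (cong not e)

  -- At a vertex b of a cycle of M △ M′ one of the two cycle edges is in M and the other
  -- in M′, since two edges at b from the same matching would coincide.
  SymDiffEdges-alternate : ∀ {a b c} → a ≢ c → SymDiffEdge M M′ a b → SymDiffEdge M M′ b c →
                           rel M′ a b ≢ rel M′ b c
  SymDiffEdges-alternate {a} {b} {c} a≢c ab bc same = a≢c (both-in (rel M′ a b) refl)
    where
    both-in : ∀ β → rel M′ a b ≡ β → a ≡ c
    both-in true  e = matching-functional isM′ b a c (trans (rel-sym M′ b a) e) (trans (sym same) e)
    both-in false e = matching-functional isM b a c
      (trans (rel-sym M b a) (SymDiffEdge⇒in-M ab e)) (SymDiffEdge⇒in-M bc (trans (sym same) e))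

  AltArc-continues-along-cycle : ∀ {a b c} → a ≢ c →
                                 SymDiffEdge M M′ a b → SymDiffEdge M M′ b c →
                                 AltArc E M′ a b → AltArc E M′ b c
  AltArc-continues-along-cycle a≢c ab bc arc =
    AltArc-continues arc (SymDiffEdge⇒Adj bc) (SymDiffEdges-alternate a≢c ab bc)

  AltArc-continues-against-cycle : ∀ {a b c} → a ≢ c →
                                   SymDiffEdge M M′ a b → SymDiffEdge M M′ b c →
                                   AltArc E M′ b a → AltArc E M′ c b
  AltArc-continues-against-cycle {a} {b} {c} a≢c ab bc (_ , e) =
    Adj-sym {E = E} {x = b} {y = c} bc-adj , (begin
    rel M′ c b       ≡⟨ rel-sym M′ c b ⟩
    rel M′ b c       ≡⟨ ¬-not (≢-sym (SymDiffEdges-alternate a≢c ab bc)) ⟩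
    not (rel M′ a b) ≡⟨ cong not (trans (rel-sym M′ a b) e) ⟩
    not (onV b)      ≡⟨ Adj⇒onV-flips bc-adj ⟨
    onV c            ∎)
    where
    bc-adj : Adj E b c
    bc-adj = SymDiffEdge⇒Adj bc

  cycle⇒Star : (c : CycleList (Vertex m n)) → IsCycleShape c →
               (∀ {a b} → CycEdge c a b → SymDiffEdge M M′ a b) →
               ∀ {a b} → a ∈ closedWalk c → b ∈ closedWalk c → Star (AltArc E M′) a b
  cycle⇒Star (x , [])             (() , _)
  cycle⇒Star (x , _ ∷ [])         (s≤s () , _)
  cycle⇒Star (x , y ∷ z ∷ xs) (_ , uniq) symdiff a∈ b∈ =
    case AltArc-orient {M = M′} (SymDiffEdge⇒Adj (symdiff (inj₁ here))) of λ where
      (inj₁ arc) → closed-Linked⇒Star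
                     (Linked-propagate AltArc-continues-along-cycle nb edges arc) closed a∈ b∈
      (inj₂ arc) → reverse id (closed-Linked⇒Star
                     (Linked-propagate AltArc-continues-against-cycle nb edges arc) closed b∈ a∈)
    where
    walk : List (Vertex m n)
    walk = closedWalk (x , y ∷ z ∷ xs)
    edges : Linked (SymDiffEdge M M′) walk
    edges = Consec⇒Linked walk (symdiff ∘ inj₁)
    nb : NonBacktracking walk
    nb = Unique⇒closed-NonBacktracking uniq
    closed : last walk ≡ just x
    closed = last-∷ʳ (x ∷ y ∷ z ∷ xs) x

  SymDiffEdge⇒Star : SymDiffUnionOfCycles M M′ → ∀ {a b} → SymDiffEdge M M′ a b →
                     Star (AltArc E M′) a b
  SymDiffEdge⇒Star (cs , shapes , _ , iff) {a} {b} (symDiffEdge ab)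
    with find (Equivalence.to (iff a b) ab)
  ... | c , c∈ , edge = cycle⇒Star c (All.lookup shapes c∈) onCycle a∈ b∈
    where
    onCycle : ∀ {x y} → CycEdge c x y → SymDiffEdge M M′ x y
    onCycle e = symDiffEdge (Equivalence.from (iff _ _) (lose c∈ e))
    a∈ : a ∈ closedWalk c
    a∈ = proj₁ (CycEdge⇒∈ c edge)
    b∈ : b ∈ closedWalk c
    b∈ = proj₂ (CycEdge⇒∈ c edge)

  AltArc-transfer : SymDiffUnionOfCycles M M′ → ∀ {a b} → AltArc E M a b → Star (AltArc E M′) a b
  AltArc-transfer sd {a} {b} (adj , e) with rel M′ a b ≟ᵇ onV a
  ... | yes e′ = (adj , e′) ◅ ε
  ... | no  ne = SymDiffEdge⇒Star sd (symDiffEdge (≢⇒xor≡true λ same → ne (trans (sym same) e)))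

  -- u lies on a cycle of M △ M′, a directed cycle of M′'s alternating digraph, and an
  -- arc entering a vertex of U is an edge of M′.
  saturated-transfer : SymDiffUnionOfCycles M M′ → ∀ {u} → SaturatedU M u → SaturatedU M′ u
  saturated-transfer sd {u} (v , e) with M′ u v in e′
  ... | true  = v , e′
  ... | false = entering-arc (Star-final-step (λ ()) (SymDiffEdge⇒Star sd {inj₂ v} {inj₁ u} vu))
    where
    vu : SymDiffEdge M M′ (inj₂ v) (inj₁ u)
    vu = symDiffEdge (cong₂ _xor_ e e′)
    entering-arc : (∃ λ y → AltArc E M′ y (inj₁ u)) → SaturatedU M′ u
    entering-arc (inj₂ v′ , _ , e″) = v′ , e″
    entering-arc (inj₁ _  , () , _)

InZ-transfer : ∀ {m n} {E M M′ : Fin m → Fin n → Bool} → IsMatching E M → IsMatching E M′ →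
               SymDiffUnionOfCycles M M′ → ∀ {w} → InZ E M w → InZ E M′ w
InZ-transfer {M′ = M′} isM isM′ sd z with InZ⇒Reachable z
... | u , unsat , path = Reachable⇒InZ (u , unsat′ , (path >>= AltArc-transfer isM isM′ sd))
  where
  unsat′ : ¬ SaturatedU M′ u
  unsat′ = unsat ∘ saturated-transfer isM′ isM (SymDiffUnionOfCycles-sym sd)

InK-cong : ∀ {m n} {E M M′ : Fin m → Fin n → Bool} →
           (∀ {w} → InZ E M w ⇔ InZ E M′ w) → ∀ x → InK E M x ⇔ InK E M′ x
InK-cong Z⇔Z′ (inj₁ u) =
  mk⇔ (λ u∉Z → u∉Z ∘ Equivalence.from Z⇔Z′) (λ u∉Z′ → u∉Z′ ∘ Equivalence.to Z⇔Z′)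
InK-cong Z⇔Z′ (inj₂ v) = Z⇔Z′

proposition3p6 : (m n : ℕ) → m ≤ n → (E : Fin m → Fin n → Bool) → Connected E →
    (M M′ : Fin m → Fin n → Bool) → IsMatching E M → IsMatching E M′ →
    SymDiffUnionOfCycles M M′ →
    ∀ x → InK E M x ⇔ InK E M′ x
proposition3p6 _ _ _ _ _ _ _ isM isM′ sd =
  InK-cong (mk⇔ (InZ-transfer isM isM′ sd) (InZ-transfer isM′ isM (SymDiffUnionOfCycles-sym sd)))
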